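{- If $G$ is any of the following graphs, then $\bar{\gamma}_p(G)=0$: (1) $\overline{C_n}$ for $n\ge 5$; (2) $\overline{P_n}$ for $n\ge 4$; (3) the cycle $C_n=v_1v_2\cdots v_nv_1$ together with the $k$ chords $\{v_1,v_i\},\{v_1,v_{i+1}\},\dots,\{v_1,v_{i+k-1}\}$, where $i\ge 3$, $n\ge 4$ and $i+k\le n-1$; (4) the cycle $C_n=v_1v_2\cdots v_nv_1$ together with the $k+1$ chords $\{v_1,v_i\},\{v_1,v_{i+1}\},\dots,\{v_1,v_{i+k-1}\}$ and $\{v_2,v_{i-1}\}$, where $i\ge 5$, $n\ge 6$ and $i+k\le n-1$; (5) $G'\vee H$, where $\bar{\gamma}_p(G')=0$ and either $\bar{\gamma}_p(H)=0$ or $H=\overline{K_2}$.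
   Context: $\overline{G}$ denotes the complement graph; $C_n$, $P_n$ are the cycle and path on $n$ vertices; $\overline{K_2}$ is two vertices with no edge; $G'\vee H$ is the join (disjoint union plus all edges between $V(G')$ and $V(H)$). For $v\in V$, $N[v]$ is the closed neighborhood; for $S\subseteq V$, $N[S]=\bigcup_{v\in S}N[v]$. Define $\mathcal{P}^0(S)=N[S]$, $\mathcal{P}^{i+1}(S)=\mathcal{P}^i(S)\cup\{w : \{w\}=N[v]\setminus\mathcal{P}^i(S)\text{ for some } v\in\mathcal{P}^i(S)\}$, with eventual value $\mathcal{P}^\infty(S)$. $S$ is a power dominating set (PDS) if $\mathcal{P}^\infty(S)=V$, and a failed power dominating set (FPDS) otherwise. $\bar{\gamma}_p(G)$ is the maximum cardinality of an FPDS of $G$. -}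

module Defs where

open import Data.Nat using (ℕ; zero; suc; _+_; _≤_; _≡ᵇ_; _≤ᵇ_; _<ᵇ_)
open import Data.Fin using (Fin; toℕ; splitAt; _≟_)
open import Data.Fin.Subset using (Subset; _∈_; _∉_; ∣_∣)
open import Data.Bool using (Bool; true; false; _∧_; _∨_; not)
open import Data.Sum using (_⊎_; inj₁; inj₂)
open import Data.Product using (Σ; ∃; ∃-syntax; _×_; _,_)
open import Relation.Nullary using (¬_)
open import Relation.Nullary.Decidable using (⌊_⌋)
open import Relation.Binary.PropositionalEquality using (_≡_)

Adj : ℕ → Set
Adj n = Fin n → Fin n → Bool

IsSimple : ∀ {n} → Adj n → Set
IsSimple {n} G = (∀ u v → G u v ≡ G v u) × (∀ v → G v v ≡ false)

-- closed neighbourhood: u ∈ N[v]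
InN : ∀ {n} → Adj n → Fin n → Fin n → Set
InN G v u = (u ≡ v) ⊎ (G v u ≡ true)

P : ∀ {n} → Adj n → Subset n → ℕ → Fin n → Set
P G S zero w = ∃[ v ] (v ∈ S × InN G v w)
P G S (suc i) w =
  P G S i w ⊎
  (∃[ v ] (P G S i v × InN G v w × ¬ P G S i w ×
           (∀ u → InN G v u → ¬ P G S i u → u ≡ w)))

IsPDS : ∀ {n} → Adj n → Subset n → Set
IsPDS {n} G S = ∀ (w : Fin n) → ∃[ i ] P G S i w

IsFPDS : ∀ {n} → Adj n → Subset n → Set
IsFPDS G S = ¬ IsPDS G S

FPDSNumber : ∀ {n} → Adj n → ℕ → Set
FPDSNumber {n} G k =
  (∃[ S ] (IsFPDS G S × ∣ S ∣ ≡ k)) × (∀ (S : Subset n) → IsFPDS G S → ∣ S ∣ ≤ k)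

compl : ∀ {n} → Adj n → Adj n
compl G u v = not (G u v) ∧ not ⌊ u ≟ v ⌋

-- path P_n = v_1 … v_n, with v_j the vertex of index j-1
pathG : (n : ℕ) → Adj n
pathG n u v = (suc (toℕ u) ≡ᵇ toℕ v) ∨ (suc (toℕ v) ≡ᵇ toℕ u)

-- cycle C_n = v_1 v_2 … v_n v_1 (a cycle for n ≥ 3)
cycleG : (n : ℕ) → Adj n
cycleG n u v = pathG n u v
  ∨ ((toℕ u ≡ᵇ 0) ∧ (suc (toℕ v) ≡ᵇ n))
  ∨ ((toℕ v ≡ᵇ 0) ∧ (suc (toℕ u) ≡ᵇ n))

-- "v_a = u and v_b = v" where v_j has index j-1
isEdge : ∀ {n} → ℕ → ℕ → Fin n → Fin n → Bool
isEdge a b u v = ((suc (toℕ u) ≡ᵇ a) ∧ (suc (toℕ v) ≡ᵇ b))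
               ∨ ((suc (toℕ u) ≡ᵇ b) ∧ (suc (toℕ v) ≡ᵇ a))

fanChord : ∀ {n} → ℕ → ℕ → Fin n → Fin n → Bool
fanChord i k u v = ((toℕ u ≡ᵇ 0) ∧ (i ≤ᵇ suc (toℕ v)) ∧ (suc (toℕ v) <ᵇ i + k))
                 ∨ ((toℕ v ≡ᵇ 0) ∧ (i ≤ᵇ suc (toℕ u)) ∧ (suc (toℕ u) <ᵇ i + k))

fanCycle : (n i k : ℕ) → Adj n
fanCycle n i k u v = cycleG n u v ∨ fanChord i k u v

fanCycle' : (n i k : ℕ) → Adj n
fanCycle' n i k u v = fanCycle n i k u v ∨ isEdge 2 (i Data.Nat.∸ 1) u v

join : ∀ {m n} → Adj m → Adj n → Adj (m + n)
join {m} G H u v with splitAt m u | splitAt m v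
... | inj₁ a | inj₁ b = G a b
... | inj₂ a | inj₂ b = H a b
... | inj₁ _ | inj₂ _ = true
... | inj₂ _ | inj₁ _ = true

module Submission where

-- Theorem 4: γ̄_p(G) = 0 for the five families of graphs, i.e. every
-- nonempty vertex set is a power dominating set (PDS), so the empty set is
-- the only failed one.  Vertices are named by their index: v_j has index j-1.
--
-- Closure: the observed set P^∞(S) is closed under the forcing rule, grows
--   with S, and observation transfers along adjacency-preserving maps.  So
--   γ̄_p(G) = 0 as soon as every singleton {v} is a PDS.  Forcing is restated on
--   indices, for a graph and for its complement, together with sweeps: two
--   consecutive observed vertices observe a whole run of vertices that have
--   no unobserved neighbours besides their path-neighbours.
-- Families (1), (2): in C̄_n and P̄_n the seed v observes everything except
--   its at most two path-neighbours, which are then forced one by one.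
-- Families (3), (4): once the hub v_1 (for (4) also v_2) is observed, every
--   other vertex is swept; the hub is reached by a case analysis on v.
-- Family (5): a seed on one side of G' ∨ H observes the other side, and its
--   own side by the hypothesis on G' or H (directly when H = K̄₂).

open import Defs
open import Data.Nat
  using (ℕ; zero; suc; _+_; _≤_; _<_; _∸_; _⊔_; z≤n; s≤s; _≤?_; _<?_; _≡ᵇ_; _≤ᵇ_; _<ᵇ_)
open import Data.Nat.Properties
  using (≤-refl; ≤-trans; <-trans; ≤-<-trans; <⇒≤; ≤-pred; n≤1+n; m≤n+m; m≤m⊔n; m≤n⊔m;
         m∸n+n≡m; m∸n≤m; m<m+n; <-irrefl; ≤-antisym; m+n≮n; <⇒≢; >⇒≢; ≰⇒>; ≮⇒≥;
         m≤n⇒m<n∨m≡n; m<n⇒m<1+n; m≤n⇒m≤1+n; ≡ᵇ⇒≡; ≡⇒≡ᵇ; ≤ᵇ⇒≤; ≤⇒≤ᵇ; <ᵇ⇒<; <⇒<ᵇ)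
open import Data.Fin using (Fin; toℕ; fromℕ<; splitAt; _↑ˡ_; _↑ʳ_)
  renaming (zero to fzero; suc to fsuc)
import Data.Fin as Fin
open import Data.Fin.Properties
  using (any?; all?; toℕ-injective; toℕ<n; toℕ-fromℕ<;
         splitAt-↑ˡ; splitAt-↑ʳ; splitAt⁻¹-↑ˡ; splitAt⁻¹-↑ʳ; ↑ˡ-injective; ↑ʳ-injective)
open import Data.Fin.Subset using (Subset; _∈_; ∣_∣; ⁅_⁆; ⊥; Nonempty)
open import Data.Fin.Subset.Properties
  using (_∈?_; ∉⊥; nonempty?; Empty-unique; ∣⊥∣≡0; ∣⁅x⁆∣≡1; x∈⁅x⁆; x∈⁅y⁆⇒x≡y)
open import Data.Bool using (true; false; T; _∧_; _∨_)
import Data.Bool as Bool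
open import Data.Bool.Properties using (T-∨; T-∧; T-≡)
open import Data.Sum using (_⊎_; inj₁; inj₂; [_,_]′)
import Data.Sum as Sum
open import Data.Product using (∃-syntax; _×_; _,_; proj₁; proj₂)
import Data.Product as Product
open import Data.Empty using (⊥-elim)
open import Function using (id; _∘_)
open import Function.Bundles using (Equivalence)
open import Relation.Nullary using (¬_; Dec; yes; no)
open import Relation.Nullary.Decidable using (_⊎-dec_; _×-dec_; _→-dec_; ¬?; T?)
open import Relation.Binary.PropositionalEquality
  using (_≡_; _≢_; refl; sym; trans; cong; subst)

module Closure where

  Observed : ∀ {n} → Adj n → Subset n → Fin n → Set
  Observed G S w = ∃[ i ] P G S i w

  inN? : ∀ {n} (G : Adj n) v u → Dec (InN G v u)
  inN? G v u = (u Fin.≟ v) ⊎-dec (G v u Bool.≟ true)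

  -- Each stage P^i(S) is decidable; needed to decide whether a vertex is
  -- already observed when applying the forcing rule.
  P? : ∀ {n} (G : Adj n) S i w → Dec (P G S i w)
  P? G S zero w = any? λ v → (v ∈? S) ×-dec inN? G v w
  P? G S (suc i) w = P? G S i w ⊎-dec any? λ v →
    P? G S i v ×-dec inN? G v w ×-dec ¬? (P? G S i w)
      ×-dec all? (λ u → inN? G v u →-dec (¬? (P? G S i u) →-dec (u Fin.≟ w)))

  P-mono : ∀ {n} (G : Adj n) S w {i j} → i ≤ j → P G S i w → P G S j w
  P-mono G S w {i} {j} i≤j p = subst (λ k → P G S k w) (m∸n+n≡m i≤j) (later (j ∸ i))
    where
    later : ∀ d → P G S (d + i) w
    later zero = p
    later (suc d) = inj₁ (later d)

  common-stage : ∀ {n} (R : ℕ → Fin n → Set) → (∀ {i j u} → i ≤ j → R i u → R j u)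
    → (∀ u → ∃[ j ] R j u) → ∃[ J ] (∀ u → R J u)
  common-stage {zero} R mono h = 0 , λ ()
  common-stage {suc n} R mono h with h fzero | common-stage (λ j u → R j (fsuc u)) mono (λ u → h (fsuc u))
  ... | j₀ , r₀ | J , rs =
    j₀ ⊔ J , λ { fzero → mono (m≤m⊔n j₀ J) r₀ ; (fsuc u) → mono (m≤n⊔m j₀ J) (rs u) }

  force-stage : ∀ {n} (G : Adj n) S i x w → P G S i x → InN G x w
    → (∀ u → InN G x u → u ≡ w ⊎ P G S i u) → P G S (suc i) w
  force-stage G S i x w px xw others with P? G S i w
  ... | yes pw = inj₁ pw
  ... | no ¬pw =
    inj₂ (x , px , xw , ¬pw , λ u hu ¬pu → [ id , (λ pu → ⊥-elim (¬pu pu)) ]′ (others u hu))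

  -- All these vertices
  -- are observed by a common stage, and one more step observes w.
  force : ∀ {n} (G : Adj n) S x w → Observed G S x → InN G x w
    → (∀ u → InN G x u → u ≡ w ⊎ Observed G S u) → Observed G S w
  force {n} G S x w (jx , px) xw others =
    suc K , force-stage G S K x w (P-mono G S x (m≤n⊔m J jx) px) xw others-by-K
    where
    R : ℕ → Fin n → Set
    R j u = InN G x u → u ≡ w ⊎ P G S j u
    mono : ∀ {i j u} → i ≤ j → R i u → R j u
    mono i≤j r hu = Sum.map₂ (P-mono G S _ i≤j) (r hu)
    eventually : ∀ u → ∃[ j ] R j u
    eventually u with inN? G x u
    ... | no ¬hu = 0 , λ hu → ⊥-elim (¬hu hu)
    ... | yes hu with others u hu
    ...   | inj₁ e = 0 , λ _ → inj₁ e
    ...   | inj₂ (j , p) = j , λ _ → inj₂ p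
    common : ∃[ J ] (∀ u → R J u)
    common = common-stage R mono eventually
    J K : ℕ
    J = proj₁ common
    K = J ⊔ jx
    others-by-K : ∀ u → InN G x u → u ≡ w ⊎ P G S K u
    others-by-K u hu = Sum.map₂ (P-mono G S u (m≤m⊔n J jx)) (proj₂ common u hu)

  transfer : ∀ {a b} (G : Adj a) (G₂ : Adj b) (f : Fin a → Fin b) (S : Subset a) (T : Subset b)
    → (∀ x u → InN G x u → InN G₂ (f x) (f u))
    → (∀ x u′ → InN G₂ (f x) u′ → (∃[ u ] (u′ ≡ f u × InN G x u)) ⊎ Observed G₂ T u′)
    → (∀ v w → v ∈ S → InN G v w → Observed G₂ T (f w))
    → ∀ i w → P G S i w → Observed G₂ T (f w)
  transfer G G₂ f S T pres back base zero w (v , v∈S , vw) = base v w v∈S vw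
  transfer G G₂ f S T pres back base (suc i) w (inj₁ p) = transfer G G₂ f S T pres back base i w p
  transfer G G₂ f S T pres back base (suc i) w (inj₂ (x , px , xw , ¬pw , unique)) =
    force G₂ T (f x) (f w) (transfer G G₂ f S T pres back base i x px) (pres x w xw) others
    where
    others : ∀ u′ → InN G₂ (f x) u′ → u′ ≡ f w ⊎ Observed G₂ T u′
    others u′ h with back x u′ h
    ... | inj₂ q = inj₂ q
    ... | inj₁ (u , refl , hu) with P? G S i u
    ...   | yes pu = inj₂ (transfer G G₂ f S T pres back base i u pu)
    ...   | no ¬pu = inj₁ (cong f (unique u hu ¬pu))

  pds-superset : ∀ {n} (G : Adj n) S T → (∀ v → v ∈ S → v ∈ T) → IsPDS G S → IsPDS G T
  pds-superset G S T S⊆T pds w with pds w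
  ... | i , p = transfer G G (λ x → x) S T (λ x u h → h) (λ x u′ h → inj₁ (u′ , refl , h))
                  (λ v w v∈S h → 0 , v , S⊆T v v∈S , h) i w p

  empty-fpds : ∀ {n} (G : Adj n) → Fin n → IsFPDS G ⊥
  empty-fpds G v pds = nothing (proj₁ (pds v)) v (proj₂ (pds v))
    where
    nothing : ∀ i w → ¬ P G ⊥ i w
    nothing zero w (u , u∈⊥ , _) = ∉⊥ u∈⊥
    nothing (suc i) w (inj₁ p) = nothing i w p
    nothing (suc i) w (inj₂ (u , pu , _)) = nothing i u pu

  fpds-zero : ∀ {n} (G : Adj n) → Fin n → (∀ S → Nonempty S → ¬ IsFPDS G S) → FPDSNumber G 0
  fpds-zero {n} G v never-fails = (⊥ , empty-fpds G v , ∣⊥∣≡0 n) , bound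
    where
    bound : ∀ S → IsFPDS G S → ∣ S ∣ ≤ 0
    bound S fails with nonempty? S
    ... | yes ne = ⊥-elim (never-fails S ne fails)
    ... | no ¬ne rewrite Empty-unique ¬ne | ∣⊥∣≡0 n = z≤n

  -- By monotonicity it suffices that every singleton is a PDS.
  fpds-zero-singletons : ∀ {n} (G : Adj n) → Fin n → (∀ v → IsPDS G ⁅ v ⁆) → FPDSNumber G 0
  fpds-zero-singletons G v pds₁ = fpds-zero G v λ S (x , x∈S) fails →
    fails (pds-superset G ⁅ x ⁆ S (λ y y∈ → subst (_∈ S) (sym (x∈⁅y⁆⇒x≡y x y∈)) x∈S)
                        (pds₁ x))

  singleton-never-fails : ∀ {n} (G : Adj n) → FPDSNumber G 0 → ∀ v → ¬ IsFPDS G ⁅ v ⁆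
  singleton-never-fails G (_ , bound) v fails with subst (_≤ 0) (∣⁅x⁆∣≡1 v) (bound ⁅ v ⁆ fails)
  ... | ()

  -- ... and the graph has a vertex, since on no vertices every set is a PDS.
  fpds-zero-vertex : ∀ {n} (G : Adj n) → FPDSNumber G 0 → Fin n
  fpds-zero-vertex {zero} G ((S , fails , _) , _) = ⊥-elim (fails λ ())
  fpds-zero-vertex {suc n} G _ = fzero

module Indexed where
  open Closure

  record Describes {n : ℕ} (G : Adj n) (A : ℕ → ℕ → Set) : Set where
    field
      sound    : ∀ u v → T (G u v) → A (toℕ u) (toℕ v)
      complete : ∀ u v → A (toℕ u) (toℕ v) → T (G u v)

  T⇒true : ∀ {b} → T b → b ≡ true
  T⇒true = Equivalence.to T-≡

  true⇒T : ∀ {b} → b ≡ true → T b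
  true⇒T = Equivalence.from T-≡

  module _ {n : ℕ} where
    open Describes

    describes-≡ᵇ : (f g : ℕ → ℕ → ℕ)
      → Describes {n} (λ u v → f (toℕ u) (toℕ v) ≡ᵇ g (toℕ u) (toℕ v)) (λ a b → f a b ≡ g a b)
    describes-≡ᵇ f g = record
      { sound    = λ u v → ≡ᵇ⇒≡ (f (toℕ u) (toℕ v)) (g (toℕ u) (toℕ v))
      ; complete = λ u v → ≡⇒≡ᵇ (f (toℕ u) (toℕ v)) (g (toℕ u) (toℕ v)) }

    describes-≤ᵇ : (f g : ℕ → ℕ → ℕ)
      → Describes {n} (λ u v → f (toℕ u) (toℕ v) ≤ᵇ g (toℕ u) (toℕ v)) (λ a b → f a b ≤ g a b)
    describes-≤ᵇ f g = record
      { sound    = λ u v → ≤ᵇ⇒≤ (f (toℕ u) (toℕ v)) (g (toℕ u) (toℕ v))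
      ; complete = λ u v → ≤⇒≤ᵇ }

    describes-<ᵇ : (f g : ℕ → ℕ → ℕ)
      → Describes {n} (λ u v → f (toℕ u) (toℕ v) <ᵇ g (toℕ u) (toℕ v)) (λ a b → f a b < g a b)
    describes-<ᵇ f g = record
      { sound    = λ u v → <ᵇ⇒< (f (toℕ u) (toℕ v)) (g (toℕ u) (toℕ v))
      ; complete = λ u v → <⇒<ᵇ }

    describes-∨ : ∀ {G H : Adj n} {A B : ℕ → ℕ → Set} → Describes G A → Describes H B
      → Describes (λ u v → G u v ∨ H u v) (λ a b → A a b ⊎ B a b)
    describes-∨ dG dH = record
      { sound    = λ u v t → Sum.map (sound dG u v) (sound dH u v) (Equivalence.to T-∨ t)
      ; complete = λ u v c → Equivalence.from T-∨ (Sum.map (complete dG u v) (complete dH u v) c) }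

    describes-∧ : ∀ {G H : Adj n} {A B : ℕ → ℕ → Set} → Describes G A → Describes H B
      → Describes (λ u v → G u v ∧ H u v) (λ a b → A a b × B a b)
    describes-∧ dG dH = record
      { sound    = λ u v t → Product.map (sound dG u v) (sound dH u v) (Equivalence.to T-∧ t)
      ; complete = λ u v c → Equivalence.from T-∧ (Product.map (complete dG u v) (complete dH u v) c) }

  climb : (Q : ℕ → Set) (a hi : ℕ)
    → (∀ c → a ≤ c → suc (suc c) ≤ hi → Q c → Q (suc c) → Q (suc (suc c)))
    → Q a → Q (suc a) → ∀ d → a ≤ d → d ≤ hi → Q d
  climb Q a hi next Qa Qsa d a≤d d≤hi =
    subst Q (m∸n+n≡m a≤d) (proj₁ (pair (d ∸ a) (subst (_≤ hi) (sym (m∸n+n≡m a≤d)) d≤hi)))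
    where
    pair : ∀ t → t + a ≤ hi → Q (t + a) × (suc t + a ≤ hi → Q (suc t + a))
    pair zero _ = Qa , λ _ → Qsa
    pair (suc t) le with pair t (≤-trans (n≤1+n _) le)
    ... | q₀ , q₁ = q₁ le , λ le′ → next (t + a) (m≤n+m a t) le′ q₀ (q₁ le)

  descend : (Q : ℕ → Set) (L a : ℕ)
    → (∀ c → L ≤ c → c < a → Q (suc c) → Q (suc (suc c)) → Q c)
    → Q a → Q (suc a) → ∀ d → L ≤ d → d ≤ suc a → Q d
  descend Q L a prev Qa Qsa d L≤d d≤sa with m≤n⇒m<n∨m≡n d≤sa
  ... | inj₂ refl = Qsa
  ... | inj₁ (s≤s d≤a) with m≤n⇒m<n∨m≡n d≤a
  ...   | inj₂ refl = Qa
  descend Q L (suc a′) prev Qa Qsa d L≤d _ | inj₁ _ | inj₁ (s≤s d≤a′) =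
    descend Q L a′ (λ c L≤c c<a′ → prev c L≤c (m<n⇒m<1+n c<a′)) Qa′ Qa
      d L≤d (m≤n⇒m≤1+n d≤a′)
    where
    Qa′ : Q a′
    Qa′ = prev a′ (≤-trans L≤d d≤a′) ≤-refl Qa Qsa

  one-of-two : ∀ {m s} → m ≤ s → s ≤ suc m → s ≡ m ⊎ s ≡ suc m
  one-of-two m≤s s≤sm with m≤n⇒m<n∨m≡n s≤sm
  ... | inj₂ e = inj₂ e
  ... | inj₁ (s≤s s≤m) = inj₁ (≤-antisym s≤m m≤s)

  Consecutive : ℕ → ℕ → Set
  Consecutive a b = suc a ≡ b ⊎ suc b ≡ a

  module IndexForcing {n : ℕ} (G : Adj n) (S : Subset n) where
    -- the vertex of index d, if there is one, is observed
    Obs : ℕ → Set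
    Obs d = ∀ u → toℕ u ≡ d → Observed G S u

    obs-beyond : ∀ d → n ≤ d → Obs d
    obs-beyond d n≤d u refl = ⊥-elim (<-irrefl refl (≤-trans (toℕ<n u) n≤d))

    force-index : ∀ c d → c < n → Obs c
      → (∀ x u → toℕ x ≡ c → toℕ u ≡ d → InN G x u)
      → (∀ x u → toℕ x ≡ c → InN G x u → toℕ u ≡ d ⊎ Obs (toℕ u)) → Obs d
    force-index c d c<n obs-c c~d others w w-at =
      force G S x w (obs-c x x-at) (c~d x w x-at w-at) others′
      where
      x : Fin n
      x = fromℕ< c<n
      x-at : toℕ x ≡ c
      x-at = toℕ-fromℕ< c<n
      others′ : ∀ u → InN G x u → u ≡ w ⊎ Observed G S u
      others′ u h with others x u x-at h
      ... | inj₁ e = inj₁ (toℕ-injective (trans e (sym w-at)))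
      ... | inj₂ obs = inj₂ (obs u refl)

    pds-from-obs : (∀ d → Obs d) → IsPDS G S
    pds-from-obs all w = all (toℕ w) w refl

  module Direct {n : ℕ} (A : ℕ → ℕ → Set) (G : Adj n) (desc : Describes G A)
                (v : Fin n) (s : ℕ) (v-at : toℕ v ≡ s) where
    open Describes desc
    open IndexForcing G ⁅ v ⁆ public

    seed : ∀ e → e ≡ s ⊎ A s e → Obs e
    seed e (inj₁ refl) u u-at = 0 , v , x∈⁅x⁆ v , inj₁ (toℕ-injective (trans u-at (sym v-at)))
    seed e (inj₂ s~e) u refl =
      0 , v , x∈⁅x⁆ v , inj₂ (T⇒true (complete v u (subst (λ a → A a (toℕ u)) (sym v-at) s~e)))

    step : ∀ c d → c < n → Obs c → A c d → (∀ e → A c e → e ≡ d ⊎ Obs e) → Obs d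
    step c d c<n obs-c c~d others = force-index c d c<n obs-c adjacent others′
      where
      adjacent : ∀ x u → toℕ x ≡ c → toℕ u ≡ d → InN G x u
      adjacent x u refl refl = inj₂ (T⇒true (complete x u c~d))
      others′ : ∀ x u → toℕ x ≡ c → InN G x u → toℕ u ≡ d ⊎ Obs (toℕ u)
      others′ x u refl (inj₁ refl) = inj₂ obs-c
      others′ x u refl (inj₂ e) = others (toℕ u) (sound x u (true⇒T e))

    finish : (∀ d → d < n → Obs d) → IsPDS G ⁅ v ⁆
    finish obs = pds-from-obs λ d → all d
      where
      all : ∀ d → Obs d
      all d with d <? n
      ... | yes d<n = obs d d<n
      ... | no d≮n = obs-beyond d (≮⇒≥ d≮n)

    Local : ℕ → Set
    Local c = ∀ e → A c e → Consecutive c e ⊎ Obs e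

    sweep : (∀ c → A c (suc c)) → (∀ c → A (suc c) c)
      → ∀ {L a hi} → L ≤ a → suc a ≤ hi → hi < n → (∀ c → L < c → c < hi → Local c)
      → Obs a → Obs (suc a) → ∀ d → L ≤ d → d ≤ hi → Obs d
    sweep up down {L} {a} {hi} L≤a a<hi hi<n local obs-a obs-sa d L≤d d≤hi with d ≤? suc a
    ... | yes d≤sa = descend Obs L a backward obs-a obs-sa d L≤d d≤sa
      where
      backward : ∀ c → L ≤ c → c < a → Obs (suc c) → Obs (suc (suc c)) → Obs c
      backward c L≤c c<a obs₁ obs₂ = step (suc c) c (<-trans sc<hi hi<n) obs₁ (down c) others
        where
        sc<hi : suc c < hi
        sc<hi = ≤-trans (s≤s c<a) a<hi
        others : ∀ e → A (suc c) e → e ≡ c ⊎ Obs e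
        others e h with local (suc c) (s≤s L≤c) sc<hi e h
        ... | inj₁ (inj₁ refl) = inj₂ obs₂
        ... | inj₁ (inj₂ refl) = inj₁ refl
        ... | inj₂ obs = inj₂ obs
    ... | no d≰sa =
      climb Obs a hi forward obs-a obs-sa d (≤-trans (n≤1+n a) (<⇒≤ (≰⇒> d≰sa))) d≤hi
      where
      forward : ∀ c → a ≤ c → suc (suc c) ≤ hi → Obs c → Obs (suc c) → Obs (suc (suc c))
      forward c a≤c ssc≤hi obs₀ obs₁ =
        step (suc c) (suc (suc c)) (≤-<-trans (n≤1+n (suc c)) (≤-<-trans ssc≤hi hi<n)) obs₁ (up (suc c))
          others
        where
        others : ∀ e → A (suc c) e → e ≡ suc (suc c) ⊎ Obs e
        others e h with local (suc c) (s≤s (≤-trans L≤a a≤c)) ssc≤hi e h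
        ... | inj₁ (inj₁ refl) = inj₁ refl
        ... | inj₁ (inj₂ refl) = inj₂ obs₀
        ... | inj₂ obs = inj₂ obs

  module Complement {n : ℕ} (A : ℕ → ℕ → Set) (B : Adj n) (desc : Describes B A)
                    (v : Fin n) (s : ℕ) (v-at : toℕ v ≡ s) where
    open Describes desc
    open IndexForcing (compl B) ⁅ v ⁆ public

    compl-nbr : ∀ x u → InN (compl B) x u → toℕ u ≡ toℕ x ⊎ ¬ A (toℕ x) (toℕ u)
    compl-nbr x u (inj₁ e) = inj₁ (cong toℕ e)
    compl-nbr x u (inj₂ e) with B x u in eq
    -- (when B x u = true, e : false ≡ true, so that case is impossible)
    ... | false = inj₂ λ a → subst T eq (complete x u a)

    compl-adj : ∀ x u → ¬ A (toℕ x) (toℕ u) → InN (compl B) x u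
    compl-adj x u ¬a with u Fin.≟ x
    ... | yes e = inj₁ e
    ... | no u≢x with B x u in eq | x Fin.≟ u
    ...   | true | _ = ⊥-elim (¬a (sound x u (true⇒T eq)))
    ...   | false | yes e = ⊥-elim (u≢x (sym e))
    ...   | false | no _ = inj₂ refl

    seed : ∀ e → e ≡ s ⊎ ¬ A s e → Obs e
    seed e (inj₁ refl) u u-at = 0 , v , x∈⁅x⁆ v , inj₁ (toℕ-injective (trans u-at (sym v-at)))
    seed e (inj₂ ¬s~e) u refl =
      0 , v , x∈⁅x⁆ v , compl-adj v u (subst (λ a → ¬ A a (toℕ u)) (sym v-at) ¬s~e)

    nbr-or-seen : ∀ u → A s (toℕ u) ⊎ Obs (toℕ u)
    nbr-or-seen u with T? (B v u)
    ... | yes edge = inj₁ (subst (λ b → A b (toℕ u)) v-at (sound v u edge))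
    ... | no ¬edge =
      inj₂ (seed (toℕ u) (inj₂ λ a → ¬edge (complete v u (subst (λ b → A b (toℕ u)) (sym v-at) a))))

    -- c forces its complement-neighbour d when every B-neighbour e of v
    -- (the only possibly unobserved vertices) is observed, is d, or is a
    -- B-neighbour of c.
    step : ∀ c d → c < n → Obs c → ¬ A c d → (∀ e → A s e → Obs e ⊎ e ≡ d ⊎ A c e) → Obs d
    step c d c<n obs-c ¬c~d others = force-index c d c<n obs-c adjacent others′
      where
      adjacent : ∀ x u → toℕ x ≡ c → toℕ u ≡ d → InN (compl B) x u
      adjacent x u refl refl = compl-adj x u ¬c~d
      others′ : ∀ x u → toℕ x ≡ c → InN (compl B) x u → toℕ u ≡ d ⊎ Obs (toℕ u)
      others′ x u refl h with compl-nbr x u h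
      ... | inj₁ e = inj₂ (subst Obs (sym e) obs-c)
      ... | inj₂ ¬c~u with nbr-or-seen u
      ...   | inj₂ obs = inj₂ obs
      ...   | inj₁ s~u with others (toℕ u) s~u
      ...     | inj₁ obs = inj₂ obs
      ...     | inj₂ (inj₁ e) = inj₁ e
      ...     | inj₂ (inj₂ c~u) = ⊥-elim (¬c~u c~u)

    finish : (∀ e → A s e → Obs e) → IsPDS (compl B) ⁅ v ⁆
    finish obs w with nbr-or-seen w
    ... | inj₁ s~w = obs (toℕ w) s~w w refl
    ... | inj₂ obs-w = obs-w w refl

    one-step : ∀ c x → (∀ e → A s e → e ≡ x ⊎ Obs e) → c < n → ¬ A s c → ¬ A c x
      → IsPDS (compl B) ⁅ v ⁆
    one-step c x nbrs c<n ¬s~c ¬c~x = finish λ e s~e → [ (λ { refl → obs-x }) , id ]′ (nbrs e s~e)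
      where
      obs-x : Obs x
      obs-x = step c x c<n (seed c (inj₂ ¬s~c)) ¬c~x λ e s~e → Sum.map₂ inj₁ (Sum.swap (nbrs e s~e))

    two-step : ∀ c x y → (∀ e → A s e → e ≡ x ⊎ e ≡ y ⊎ Obs e) → c < n → x < n → ¬ A s c
      → ¬ A c x → A c y → ¬ A x y → IsPDS (compl B) ⁅ v ⁆
    two-step c x y nbrs c<n x<n ¬s~c ¬c~x c~y ¬x~y =
      finish λ e s~e → [ (λ { refl → obs-x }) , [ (λ { refl → obs-y }) , id ]′ ]′ (nbrs e s~e)
      where
      obs-x : Obs x
      obs-x = step c x c<n (seed c (inj₂ ¬s~c)) ¬c~x λ e s~e →
        [ (λ { refl → inj₂ (inj₁ refl) }) , [ (λ { refl → inj₂ (inj₂ c~y) }) , inj₁ ]′ ]′ (nbrs e s~e)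
      obs-y : Obs y
      obs-y = step x y x<n obs-x ¬x~y λ e s~e →
        [ (λ { refl → inj₁ obs-x }) , [ (λ { refl → inj₂ (inj₁ refl) }) , inj₁ ]′ ]′ (nbrs e s~e)

module PathAndCycle where
  open Indexed

  path-describes : ∀ {n} → Describes (pathG n) Consecutive
  path-describes = describes-∨ (describes-≡ᵇ (λ a _ → suc a) (λ _ b → b))
                               (describes-≡ᵇ (λ _ b → suc b) (λ a _ → a))

  CycleRel : ℕ → ℕ → ℕ → Set
  CycleRel n a b = Consecutive a b ⊎ (a ≡ 0 × suc b ≡ n) ⊎ (b ≡ 0 × suc a ≡ n)

  cycle-describes : ∀ {n} → Describes (cycleG n) (CycleRel n)
  cycle-describes {n} = describes-∨ path-describes (describes-∨ (closing (λ a _ → a) (λ _ b → b))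
                                                                (closing (λ _ b → b) (λ a _ → a)))
    where
    closing : (f g : ℕ → ℕ → ℕ)
      → Describes {n} (λ u v → (f (toℕ u) (toℕ v) ≡ᵇ 0) ∧ (suc (g (toℕ u) (toℕ v)) ≡ᵇ n))
                      (λ a b → f a b ≡ 0 × suc (g a b) ≡ n)
    closing f g = describes-∧ (describes-≡ᵇ f (λ _ _ → 0))
                              (describes-≡ᵇ (λ a b → suc (g a b)) (λ _ _ → n))

-- Family (2): P̄_n for n = 4 + r ≥ 4.  The seed v of index s has at most two
-- path-neighbours; a suitable non-neighbour of v forces one of them, which
-- then forces the other.
module ComplementOfPath (r : ℕ) (v : Fin (4 + r)) where
  open Indexed
  open PathAndCycle

  G : Adj (4 + r)
  G = compl (pathG (4 + r))

  module Seed (s : ℕ) (v-at : toℕ v ≡ s) = Complement Consecutive (pathG (4 + r)) path-describes v s v-at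

  -- v = 0: its only path-neighbour 1 is forced by 3.
  first : toℕ v ≡ 0 → IsPDS G ⁅ v ⁆
  first v-at = one-step 3 1 (λ { e (inj₁ refl) → inj₁ refl ; e (inj₂ ()) })
    (s≤s (s≤s (s≤s (s≤s z≤n))))
    (λ { (inj₁ ()) ; (inj₂ ()) }) (λ { (inj₁ ()) ; (inj₂ ()) })
    where open Seed 0 v-at

  -- v = t+1 with t ≤ r: t+3 forces t, which then forces t+2.
  inner : ∀ t → t ≤ r → toℕ v ≡ suc t → IsPDS G ⁅ v ⁆
  inner t t≤r v-at = two-step (3 + t) t (2 + t)
    (λ { e (inj₁ refl) → inj₂ (inj₁ refl) ; e (inj₂ refl) → inj₁ refl })
    (s≤s (s≤s (s≤s (s≤s t≤r)))) (≤-trans (s≤s t≤r) (m≤n+m (suc r) 3))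
    (λ { (inj₁ ()) ; (inj₂ ()) }) (λ { (inj₁ ()) ; (inj₂ ()) }) (inj₂ refl)
    (λ { (inj₁ ()) ; (inj₂ ()) })
    where open Seed (suc t) v-at

  -- v = r+2: r forces r+3, which then forces r+1.
  penultimate : toℕ v ≡ 2 + r → IsPDS G ⁅ v ⁆
  penultimate v-at = two-step r (3 + r) (1 + r)
    (λ { e (inj₁ refl) → inj₁ refl ; e (inj₂ refl) → inj₂ (inj₁ refl) })
    (m≤n+m (suc r) 3) ≤-refl
    (λ { (inj₁ ()) ; (inj₂ ()) }) (λ { (inj₁ ()) ; (inj₂ ()) }) (inj₁ refl)
    (λ { (inj₁ ()) ; (inj₂ ()) })
    where open Seed (2 + r) v-at

  -- v = r+3: its only path-neighbour r+2 is forced by r.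
  last : toℕ v ≡ 3 + r → IsPDS G ⁅ v ⁆
  last v-at = one-step r (2 + r)
    (λ { e (inj₁ refl) → inj₂ (obs-beyond (4 + r) ≤-refl) ; e (inj₂ refl) → inj₁ refl })
    (m≤n+m (suc r) 3) (λ { (inj₁ ()) ; (inj₂ ()) }) (λ { (inj₁ ()) ; (inj₂ ()) })
    where open Seed (3 + r) v-at

  pds : IsPDS G ⁅ v ⁆
  pds = by-index (toℕ v) refl (toℕ<n v)
    where
    by-index : ∀ s → toℕ v ≡ s → s < 4 + r → IsPDS G ⁅ v ⁆
    by-index zero v-at _ = first v-at
    by-index (suc t) v-at s<n with t ≤? r
    ... | yes t≤r = inner t t≤r v-at
    ... | no t≰r with one-of-two (≰⇒> t≰r) (≤-pred (≤-pred s<n))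
    ...   | inj₁ refl = penultimate v-at
    ...   | inj₂ refl = last v-at

-- Family (1): C̄_n for n = 5 + r ≥ 5; the same argument as for P̄_n, now
-- every vertex has exactly two cycle-neighbours.
module ComplementOfCycle (r : ℕ) (v : Fin (5 + r)) where
  open Indexed
  open PathAndCycle

  G : Adj (5 + r)
  G = compl (cycleG (5 + r))

  module Seed (s : ℕ) (v-at : toℕ v ≡ s) =
    Complement (CycleRel (5 + r)) (cycleG (5 + r)) cycle-describes v s v-at

  -- v = 0: 2 forces r+4, which then forces 1.
  first : toℕ v ≡ 0 → IsPDS G ⁅ v ⁆
  first v-at = two-step 2 (4 + r) 1
    (λ { e (inj₁ (inj₁ refl)) → inj₂ (inj₁ refl) ; e (inj₁ (inj₂ ())) ; e (inj₂ (inj₁ (_ , refl))) → inj₁ refl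
       ; e (inj₂ (inj₂ (refl , ()))) })
    (s≤s (s≤s (s≤s z≤n))) ≤-refl
    (λ { (inj₁ (inj₁ ())) ; (inj₁ (inj₂ ())) ; (inj₂ (inj₁ (_ , ()))) ; (inj₂ (inj₂ (() , _))) })
    (λ { (inj₁ (inj₁ ())) ; (inj₁ (inj₂ ())) ; (inj₂ (inj₁ (() , _))) ; (inj₂ (inj₂ (() , _))) })
    (inj₁ (inj₂ refl))
    (λ { (inj₁ (inj₁ ())) ; (inj₁ (inj₂ ())) ; (inj₂ (inj₁ (() , _))) ; (inj₂ (inj₂ (() , _))) })
    where open Seed 0 v-at

  -- v = t+1 with t ≤ r+1: t+3 forces t, which then forces t+2.
  inner : ∀ t → t ≤ 1 + r → toℕ v ≡ suc t → IsPDS G ⁅ v ⁆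
  inner t t≤1+r v-at = two-step (3 + t) t (2 + t)
    (λ { e (inj₁ (inj₁ refl)) → inj₂ (inj₁ refl) ; e (inj₁ (inj₂ refl)) → inj₁ refl ; e (inj₂ (inj₁ (() , _)))
       ; e (inj₂ (inj₂ (refl , refl))) → ⊥-elim (m+n≮n 1 (suc r) t≤1+r) })
    (s≤s (s≤s (s≤s (s≤s t≤1+r)))) (≤-trans (s≤s t≤1+r) (m≤n+m (2 + r) 3))
    (λ { (inj₁ (inj₁ ())) ; (inj₁ (inj₂ ())) ; (inj₂ (inj₁ (() , _))) ; (inj₂ (inj₂ (() , _))) })
    (λ { (inj₁ (inj₁ ())) ; (inj₁ (inj₂ ())) ; (inj₂ (inj₁ (() , _))) ; (inj₂ (inj₂ (refl , ()))) })
    (inj₁ (inj₂ refl))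
    (λ { (inj₁ (inj₁ ())) ; (inj₁ (inj₂ ())) ; (inj₂ (inj₁ (refl , ()))) ; (inj₂ (inj₂ (() , _))) })
    where open Seed (suc t) v-at

  -- v = r+3: 0 forces r+2, which then forces r+4.
  penultimate : toℕ v ≡ 3 + r → IsPDS G ⁅ v ⁆
  penultimate v-at = two-step 0 (2 + r) (4 + r)
    (λ { e (inj₁ (inj₁ refl)) → inj₂ (inj₁ refl) ; e (inj₁ (inj₂ refl)) → inj₁ refl ; e (inj₂ (inj₁ (() , _)))
       ; e (inj₂ (inj₂ (_ , ()))) })
    (s≤s z≤n) (m≤n+m (3 + r) 2)
    (λ { (inj₁ (inj₁ ())) ; (inj₁ (inj₂ ())) ; (inj₂ (inj₁ (() , _))) ; (inj₂ (inj₂ (_ , ()))) })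
    (λ { (inj₁ (inj₁ ())) ; (inj₁ (inj₂ ())) ; (inj₂ (inj₁ (_ , ()))) ; (inj₂ (inj₂ (() , _))) })
    (inj₂ (inj₁ (refl , refl)))
    (λ { (inj₁ (inj₁ ())) ; (inj₁ (inj₂ ())) ; (inj₂ (inj₁ (() , _))) ; (inj₂ (inj₂ (() , _))) })
    where open Seed (3 + r) v-at

  -- v = r+4: 1 forces r+3, which then forces 0.
  last : toℕ v ≡ 4 + r → IsPDS G ⁅ v ⁆
  last v-at = two-step 1 (3 + r) 0
    (λ { e (inj₁ (inj₁ refl)) → inj₂ (inj₂ (obs-beyond (5 + r) ≤-refl)) ; e (inj₁ (inj₂ refl)) → inj₁ refl
       ; e (inj₂ (inj₁ (() , _))) ; e (inj₂ (inj₂ (refl , refl))) → inj₂ (inj₁ refl) })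
    (s≤s (s≤s z≤n)) (m≤n+m (4 + r) 1)
    (λ { (inj₁ (inj₁ ())) ; (inj₁ (inj₂ ())) ; (inj₂ (inj₁ (() , _))) ; (inj₂ (inj₂ (() , _))) })
    (λ { (inj₁ (inj₁ ())) ; (inj₁ (inj₂ ())) ; (inj₂ (inj₁ (() , _))) ; (inj₂ (inj₂ (() , _))) })
    (inj₁ (inj₂ refl))
    (λ { (inj₁ (inj₁ ())) ; (inj₁ (inj₂ ())) ; (inj₂ (inj₁ (() , _))) ; (inj₂ (inj₂ (_ , ()))) })
    where open Seed (4 + r) v-at

  pds : IsPDS G ⁅ v ⁆
  pds = by-index (toℕ v) refl (toℕ<n v)
    where
    by-index : ∀ s → toℕ v ≡ s → s < 5 + r → IsPDS G ⁅ v ⁆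
    by-index zero v-at _ = first v-at
    by-index (suc t) v-at s<n with t ≤? 1 + r
    ... | yes t≤1+r = inner t t≤1+r v-at
    ... | no t≰1+r with one-of-two (≰⇒> t≰1+r) (≤-pred (≤-pred s<n))
    ...   | inj₁ refl = penultimate v-at
    ...   | inj₂ refl = last v-at

module Fan where
  open Indexed
  open PathAndCycle

  -- the vertex of index x is the other end of a chord from the hub 0
  Chord : ℕ → ℕ → ℕ → Set
  Chord i k x = i ≤ suc x × suc x < i + k

  chord? : ∀ i k x → Dec (Chord i k x)
  chord? i k x = (i ≤? suc x) ×-dec (suc x <? i + k)

  FanRel : ℕ → ℕ → ℕ → ℕ → ℕ → Set
  FanRel n i k a b = CycleRel n a b ⊎ (a ≡ 0 × Chord i k b) ⊎ (b ≡ 0 × Chord i k a)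

  fan-describes : ∀ {n i k} → Describes (fanCycle n i k) (FanRel n i k)
  fan-describes {n} {i} {k} = describes-∨ cycle-describes (describes-∨ (chord (λ a _ → a) (λ _ b → b))
                                                                    (chord (λ _ b → b) (λ a _ → a)))
    where
    chord : (f g : ℕ → ℕ → ℕ)
      → Describes {n} (λ u v → (f (toℕ u) (toℕ v) ≡ᵇ 0) ∧ (i ≤ᵇ suc (g (toℕ u) (toℕ v)))
                                  ∧ (suc (g (toℕ u) (toℕ v)) <ᵇ i + k))
                      (λ a b → f a b ≡ 0 × Chord i k (g a b))
    chord f g = describes-∧ (describes-≡ᵇ f (λ _ _ → 0))
      (describes-∧ (describes-≤ᵇ (λ _ _ → i) (λ a b → suc (g a b)))
                   (describes-<ᵇ (λ a b → suc (g a b)) (λ _ _ → i + k)))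

  fan-nbr : ∀ {n i k c e} → FanRel n i k c e → c ≢ 0 → Consecutive c e ⊎ e ≡ 0
  fan-nbr (inj₁ (inj₁ c~e)) _ = inj₁ c~e
  fan-nbr (inj₁ (inj₂ (inj₁ (c≡0 , _)))) c≢0 = ⊥-elim (c≢0 c≡0)
  fan-nbr (inj₁ (inj₂ (inj₂ (e≡0 , _)))) _ = inj₂ e≡0
  fan-nbr (inj₂ (inj₁ (c≡0 , _))) c≢0 = ⊥-elim (c≢0 c≡0)
  fan-nbr (inj₂ (inj₂ (e≡0 , _))) _ = inj₂ e≡0

  fan-nbr-plain : ∀ {n i k c e} → FanRel n i k c e → c ≢ 0 → suc c ≢ n → ¬ Chord i k c
    → Consecutive c e
  fan-nbr-plain (inj₁ (inj₁ c~e)) _ _ _ = c~e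
  fan-nbr-plain (inj₁ (inj₂ (inj₁ (c≡0 , _)))) c≢0 _ _ = ⊥-elim (c≢0 c≡0)
  fan-nbr-plain (inj₁ (inj₂ (inj₂ (_ , last)))) _ not-last _ = ⊥-elim (not-last last)
  fan-nbr-plain (inj₂ (inj₁ (c≡0 , _))) c≢0 _ _ = ⊥-elim (c≢0 c≡0)
  fan-nbr-plain (inj₂ (inj₂ (_ , chord))) _ _ not-chord = ⊥-elim (not-chord chord)

  Extra : ℕ → ℕ → ℕ → Set
  Extra i a b = (suc a ≡ 2 × suc b ≡ i ∸ 1) ⊎ (suc a ≡ i ∸ 1 × suc b ≡ 2)

  FanRel′ : ℕ → ℕ → ℕ → ℕ → ℕ → Set
  FanRel′ n i k a b = FanRel n i k a b ⊎ Extra i a b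

  fan′-describes : ∀ {n i k} → Describes (fanCycle' n i k) (FanRel′ n i k)
  fan′-describes {n} {i} {k} = describes-∨ fan-describes (describes-∨ (ends 2 (i ∸ 1)) (ends (i ∸ 1) 2))
    where
    ends : (x y : ℕ) → Describes {n} (λ u v → (suc (toℕ u) ≡ᵇ x) ∧ (suc (toℕ v) ≡ᵇ y))
                                     (λ a b → suc a ≡ x × suc b ≡ y)
    ends x y = describes-∧ (describes-≡ᵇ (λ a _ → suc a) (λ _ _ → x))
                           (describes-≡ᵇ (λ _ b → suc b) (λ _ _ → y))

-- Family (3), for every n = 4 + r, i and k: once the hub v_1 is observed the
-- remaining vertices form a path whose vertices have no further unobserved
-- neighbours, so two consecutive observed vertices observe everything.  The
-- hub is observed directly when v is the hub, a cycle-neighbour of it or a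
-- chord end; otherwise the run of chordless vertices between v and the hub
-- (on one of the two sides) is swept until it reaches the hub.
module FanCycle (r i k : ℕ) (v : Fin (4 + r)) where
  open Indexed
  open PathAndCycle
  open Fan

  G : Adj (4 + r)
  G = fanCycle (4 + r) i k

  up : ∀ c → FanRel (4 + r) i k c (suc c)
  up c = inj₁ (inj₁ (inj₁ refl))

  down : ∀ c → FanRel (4 + r) i k (suc c) c
  down c = inj₁ (inj₁ (inj₂ refl))

  suc≢0 : ∀ {c} → suc c ≢ 0
  suc≢0 ()

  module Seed (s : ℕ) (v-at : toℕ v ≡ s) = Direct (FanRel (4 + r) i k) G fan-describes v s v-at

  module _ (s : ℕ) (v-at : toℕ v ≡ s) where
    open Seed s v-at

    from-hub : Obs 0 → ∀ a → suc a < 4 + r → Obs a → Obs (suc a) → IsPDS G ⁅ v ⁆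
    from-hub obs₀ a sa<n obs-a obs-sa =
      finish λ d d<n → sweep up down z≤n (≤-pred sa<n) ≤-refl local obs-a obs-sa d z≤n (≤-pred d<n)
      where
      local : ∀ c → 0 < c → c < 3 + r → Local c
      local (suc c) _ _ e h = Sum.map₂ (λ { refl → obs₀ }) (fan-nbr h suc≢0)

    reach-hub-down : ∀ a → suc a < 4 + r → (∀ x → x ≤ a → ¬ Chord i k x)
      → Obs a → Obs (suc a) → Obs 0
    reach-hub-down a sa<n no-chord obs-a obs-sa =
      sweep up down z≤n ≤-refl sa<n local obs-a obs-sa 0 z≤n z≤n
      where
      local : ∀ c → 0 < c → c < suc a → Local c
      local (suc c) _ (s≤s sc≤a) e h =
        inj₁ (fan-nbr-plain h suc≢0 (λ { refl → <-irrefl refl (≤-<-trans (s≤s sc≤a) sa<n) })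
                            (no-chord (suc c) sc≤a))

    -- If no vertex from a+1 on is a chord end, sweeping up reaches the last
    -- vertex, whose only unobserved neighbour is then the hub.
    reach-hub-up : ∀ a → suc a < 4 + r → (∀ x → suc a ≤ x → ¬ Chord i k x)
      → Obs a → Obs (suc a) → Obs 0
    reach-hub-up a sa<n no-chord obs-a obs-sa =
      step (3 + r) 0 ≤-refl (upto (3 + r) (≤-trans (n≤1+n a) (≤-pred sa<n)) ≤-refl)
        (inj₁ (inj₂ (inj₂ (refl , refl)))) last-nbrs
      where
      local : ∀ c → a < c → c < 3 + r → Local c
      local (suc c) a<sc sc<3+r e h =
        inj₁ (fan-nbr-plain h suc≢0 (λ { refl → <-irrefl refl (s≤s sc<3+r) }) (no-chord (suc c) a<sc))
      upto : ∀ d → a ≤ d → d ≤ 3 + r → Obs d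
      upto = sweep up down ≤-refl (≤-pred sa<n) ≤-refl local obs-a obs-sa
      last-nbrs : ∀ e → FanRel (4 + r) i k (3 + r) e → e ≡ 0 ⊎ Obs e
      last-nbrs e h with fan-nbr h suc≢0
      ... | inj₁ (inj₁ refl) = inj₂ (obs-beyond (4 + r) ≤-refl)
      ... | inj₁ (inj₂ refl) = inj₂ (upto (2 + r) (≤-pred (≤-pred sa<n)) (n≤1+n _))
      ... | inj₂ e≡0 = inj₁ e≡0

  -- v is the hub: it observes itself and vertex 1.
  at-hub : toℕ v ≡ 0 → IsPDS G ⁅ v ⁆
  at-hub v-at =
    from-hub 0 v-at (seed 0 (inj₁ refl)) 0 (s≤s (s≤s z≤n)) (seed 0 (inj₁ refl)) (seed 1 (inj₂ (up 0)))
    where open Seed 0 v-at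

  -- v is the last vertex: it observes the hub and its predecessor.
  at-last : toℕ v ≡ 3 + r → IsPDS G ⁅ v ⁆
  at-last v-at =
    from-hub (3 + r) v-at (seed 0 (inj₂ (inj₁ (inj₂ (inj₂ (refl , refl)))))) (2 + r) ≤-refl
    (seed (2 + r) (inj₂ (down (2 + r)))) (seed (3 + r) (inj₁ refl))
    where open Seed (3 + r) v-at

  -- v is an inner vertex: it observes itself and its successor, and the hub
  -- is reached directly (v a chord end) or by a sweep away from the chords.
  inner : ∀ t → suc t < 3 + r → toℕ v ≡ suc t → IsPDS G ⁅ v ⁆
  inner t st<3+r v-at = from-hub (suc t) v-at obs₀ (suc t) (s≤s st<3+r) obs-v obs-next
    where
    open Seed (suc t) v-at
    obs-v : Obs (suc t)
    obs-v = seed (suc t) (inj₁ refl)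
    obs-next : Obs (2 + t)
    obs-next = seed (2 + t) (inj₂ (up (suc t)))
    obs₀ : Obs 0
    obs₀ with chord? i k (suc t) | i ≤? 2 + t
    ... | yes chord | _ = seed 0 (inj₂ (inj₂ (inj₂ (refl , chord))))
    ... | no _ | no i≰2+t = reach-hub-down (suc t) v-at (suc t) (s≤s st<3+r)
          (λ x x≤1+t (lo , _) → i≰2+t (≤-trans lo (s≤s x≤1+t))) obs-v obs-next
    ... | no not-chord | yes i≤2+t = reach-hub-up (suc t) v-at (suc t) (s≤s st<3+r)
          (λ x 2+t≤x (_ , hi) → not-chord (i≤2+t , ≤-trans (s≤s 2+t≤x) (<⇒≤ hi))) obs-v obs-next

  pds : IsPDS G ⁅ v ⁆
  pds = by-index (toℕ v) refl (toℕ<n v)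
    where
    by-index : ∀ s → toℕ v ≡ s → s < 4 + r → IsPDS G ⁅ v ⁆
    by-index zero v-at _ = at-hub v-at
    by-index (suc t) v-at s<n with m≤n⇒m<n∨m≡n (≤-pred s<n)
    ... | inj₁ st<3+r = inner t st<3+r v-at
    ... | inj₂ refl = at-last v-at

-- Family (4), for i = 5 + p ≤ n - 2 with n = 4 + r, and every k.  Let j = i - 2
-- be the index of v_{i-1}, so the extra chord joins 1 and j, and every chord
-- end lies beyond j.  Now the hub 0 and vertex 1 together play the role of
-- the hub of family (3).  They are observed directly when v is 0 or 1; from
-- a seed in [2, j] the chordless run [1, j] is swept and 1 forces 0; from a
-- seed beyond j the hub is reached as in family (3), the run [j, n-1] is
-- swept, and 0 forces 1.
module FanCycleChord (r p k : ℕ) (j<2+r : 3 + p < 2 + r) (v : Fin (4 + r)) where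
  open Indexed
  open PathAndCycle
  open Fan

  j : ℕ
  j = 3 + p

  Rel : ℕ → ℕ → Set
  Rel = FanRel′ (4 + r) (5 + p) k

  G : Adj (4 + r)
  G = fanCycle' (4 + r) (5 + p) k

  up : ∀ c → Rel c (suc c)
  up c = inj₁ (inj₁ (inj₁ (inj₁ refl)))

  down : ∀ c → Rel (suc c) c
  down c = inj₁ (inj₁ (inj₁ (inj₂ refl)))

  j<n : j < 4 + r
  j<n = ≤-trans j<2+r (m≤n+m (2 + r) 2)

  j<last : j < 3 + r
  j<last = m<n⇒m<1+n j<2+r

  extra-ends : ∀ {c e} → Extra (5 + p) c e → (c ≡ 1 × e ≡ j) ⊎ (c ≡ j × e ≡ 1)
  extra-ends (inj₁ (refl , refl)) = inj₁ (refl , refl)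
  extra-ends (inj₂ (refl , refl)) = inj₂ (refl , refl)

  not-extra : ∀ {c e} → c ≢ 1 → c ≢ j → ¬ Extra (5 + p) c e
  not-extra c≢1 c≢j x = [ (c≢1 ∘ proj₁) , (c≢j ∘ proj₁) ]′ (extra-ends x)

  Outside : ℕ → Set
  Outside c = c ≢ 0 × c ≢ 1 × c ≢ j

  outside-beyond : ∀ {c} → j < c → Outside c
  outside-beyond j<c = >⇒≢ (≤-<-trans z≤n j<c) , >⇒≢ (≤-<-trans (s≤s z≤n) j<c) , >⇒≢ j<c

  nbr-outside : ∀ {c e} → Rel c e → Outside c → Consecutive c e ⊎ e ≡ 0
  nbr-outside (inj₁ h) (c≢0 , _) = fan-nbr h c≢0
  nbr-outside (inj₂ x) (_ , c≢1 , c≢j) = ⊥-elim (not-extra c≢1 c≢j x)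

  nbr-plain : ∀ {c e} → Rel c e → Outside c → suc c ≢ 4 + r → ¬ Chord (5 + p) k c → Consecutive c e
  nbr-plain (inj₁ h) (c≢0 , _) not-last not-chord = fan-nbr-plain h c≢0 not-last not-chord
  nbr-plain (inj₂ x) (_ , c≢1 , c≢j) _ _ = ⊥-elim (not-extra c≢1 c≢j x)

  module Seed (s : ℕ) (v-at : toℕ v ≡ s) = Direct Rel G fan′-describes v s v-at

  module _ (s : ℕ) (v-at : toℕ v ≡ s) where
    open Seed s v-at

    -- With 0 and 1 observed every vertex c ≥ 2 is local, so a pair of
    -- consecutive observed vertices observes everything.
    from-hub-and-1 : Obs 0 → Obs 1 → ∀ a → 1 ≤ a → suc a < 4 + r → Obs a → Obs (suc a)
      → IsPDS G ⁅ v ⁆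
    from-hub-and-1 obs₀ obs₁ a 1≤a sa<n obs-a obs-sa = finish all
      where
      local : ∀ c → 1 < c → c < 3 + r → Local c
      local c 1<c _ e (inj₁ h) =
        Sum.map₂ (λ { refl → obs₀ }) (fan-nbr h (>⇒≢ (<-trans (s≤s z≤n) 1<c)))
      local c 1<c _ e (inj₂ x) with extra-ends x
      ... | inj₁ (refl , _) = ⊥-elim (<-irrefl refl 1<c)
      ... | inj₂ (_ , refl) = inj₂ obs₁
      all : ∀ d → d < 4 + r → Obs d
      all zero _ = obs₀
      all (suc d) d<n =
        sweep up down 1≤a (≤-pred sa<n) ≤-refl local obs-a obs-sa (suc d) (s≤s z≤n) (≤-pred d<n)

    -- A pair in the run [1, j], which contains no chord end, observes the
    -- run; then 1 forces the hub.
    from-low-pair : ∀ a → 1 ≤ a → suc a ≤ j → Obs a → Obs (suc a) → IsPDS G ⁅ v ⁆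
    from-low-pair a 1≤a sa≤j obs-a obs-sa =
      from-hub-and-1 obs₀ obs₁ 1 ≤-refl (s≤s (s≤s (s≤s z≤n))) obs₁ (low 2 (s≤s z≤n) (s≤s (s≤s z≤n)))
      where
      local : ∀ c → 1 < c → c < j → Local c
      local c 1<c c<j e h = inj₁ (nbr-plain h (>⇒≢ (<-trans (s≤s z≤n) 1<c) , >⇒≢ 1<c , <⇒≢ c<j)
        (<⇒≢ (≤-<-trans c<j j<n)) (λ (lo , _) → m+n≮n 1 j (≤-trans lo c<j)))
      low : ∀ d → 1 ≤ d → d ≤ j → Obs d
      low = sweep up down 1≤a sa≤j j<n local obs-a obs-sa
      nbrs : ∀ e → Rel 1 e → e ≡ 0 ⊎ Obs e
      nbrs e (inj₁ h) with fan-nbr h (λ ())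
      ... | inj₁ (inj₁ refl) = inj₂ (low 2 (s≤s z≤n) (s≤s (s≤s z≤n)))
      ... | inj₁ (inj₂ refl) = inj₁ refl
      ... | inj₂ e≡0 = inj₁ e≡0
      nbrs e (inj₂ x) with extra-ends x
      ... | inj₁ (_ , refl) = inj₂ (low j (s≤s z≤n) ≤-refl)
      ... | inj₂ (() , _)
      obs₁ : Obs 1
      obs₁ = low 1 ≤-refl (s≤s z≤n)
      obs₀ : Obs 0
      obs₀ = step 1 0 (s≤s (s≤s z≤n)) obs₁ (down 0) nbrs

    -- With the hub observed, a pair beyond j observes the run [j, n-1],
    -- which contains every chord end; then the hub forces 1.
    from-high-pair : Obs 0 → ∀ a → j < a → suc a < 4 + r → Obs a → Obs (suc a) → IsPDS G ⁅ v ⁆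
    from-high-pair obs₀ a j<a sa<n obs-a obs-sa =
      from-hub-and-1 obs₀ obs₁ a (≤-trans (s≤s z≤n) j<a) sa<n obs-a obs-sa
      where
      local : ∀ c → j < c → c < 3 + r → Local c
      local c j<c _ e h = Sum.map₂ (λ { refl → obs₀ }) (nbr-outside h (outside-beyond j<c))
      high : ∀ d → j ≤ d → Obs d
      high d j≤d with d ≤? 3 + r
      ... | yes d≤3+r = sweep up down (<⇒≤ j<a) (≤-pred sa<n) ≤-refl local obs-a obs-sa d j≤d d≤3+r
      ... | no d≰3+r = obs-beyond d (≰⇒> d≰3+r)
      nbrs : ∀ e → Rel 0 e → e ≡ 1 ⊎ Obs e
      nbrs e (inj₁ (inj₁ (inj₁ (inj₁ refl)))) = inj₁ refl
      nbrs e (inj₁ (inj₁ (inj₁ (inj₂ ()))))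
      nbrs e (inj₁ (inj₁ (inj₂ (inj₁ (_ , refl))))) = inj₂ (high (3 + r) (<⇒≤ j<last))
      nbrs e (inj₁ (inj₁ (inj₂ (inj₂ (refl , _))))) = inj₂ obs₀
      nbrs e (inj₁ (inj₂ (inj₁ (_ , lo , _)))) = inj₂ (high e (≤-trans (n≤1+n j) (≤-pred lo)))
      nbrs e (inj₁ (inj₂ (inj₂ (refl , _)))) = inj₂ obs₀
      nbrs e (inj₂ (inj₁ (() , _)))
      nbrs e (inj₂ (inj₂ (() , _)))
      obs₁ : Obs 1
      obs₁ = step 0 1 (s≤s z≤n) obs₀ (up 0) nbrs

    -- If no vertex from a+1 on is a chord end, sweeping up from a pair
    -- beyond j reaches the last vertex, which then forces the hub.
    reach-hub-up : ∀ a → j < a → suc a < 4 + r → (∀ x → suc a ≤ x → ¬ Chord (5 + p) k x)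
      → Obs a → Obs (suc a) → Obs 0
    reach-hub-up a j<a sa<n no-chord obs-a obs-sa =
      step (3 + r) 0 ≤-refl (upto (3 + r) (≤-trans (n≤1+n a) (≤-pred sa<n)) ≤-refl)
        (inj₁ (inj₁ (inj₂ (inj₂ (refl , refl))))) last-nbrs
      where
      local : ∀ c → a < c → c < 3 + r → Local c
      local c a<c c<3+r e h =
        inj₁ (nbr-plain h (outside-beyond (<-trans j<a a<c)) (<⇒≢ (s≤s c<3+r)) (no-chord c a<c))
      upto : ∀ d → a ≤ d → d ≤ 3 + r → Obs d
      upto = sweep up down ≤-refl (≤-pred sa<n) ≤-refl local obs-a obs-sa
      last-nbrs : ∀ e → Rel (3 + r) e → e ≡ 0 ⊎ Obs e
      last-nbrs e h with nbr-outside h (outside-beyond j<last)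
      ... | inj₁ (inj₁ refl) = inj₂ (obs-beyond (4 + r) ≤-refl)
      ... | inj₁ (inj₂ refl) = inj₂ (upto (2 + r) (≤-pred (≤-pred sa<n)) (n≤1+n _))
      ... | inj₂ e≡0 = inj₁ e≡0

  -- v is the hub: it observes 1 and the last vertex, which forces its predecessor.
  at-hub : toℕ v ≡ 0 → IsPDS G ⁅ v ⁆
  at-hub v-at =
    from-hub-and-1 0 v-at obs₀ (seed 1 (inj₂ (up 0))) (2 + r) (s≤s z≤n) ≤-refl obs-pen obs-last
    where
    open Seed 0 v-at
    obs₀ : Obs 0
    obs₀ = seed 0 (inj₁ refl)
    obs-last : Obs (3 + r)
    obs-last = seed (3 + r) (inj₂ (inj₁ (inj₁ (inj₂ (inj₁ (refl , refl))))))
    last-nbrs : ∀ e → Rel (3 + r) e → e ≡ 2 + r ⊎ Obs e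
    last-nbrs e h with nbr-outside h (outside-beyond j<last)
    ... | inj₁ (inj₁ refl) = inj₂ (obs-beyond (4 + r) ≤-refl)
    ... | inj₁ (inj₂ refl) = inj₁ refl
    ... | inj₂ refl = inj₂ obs₀
    obs-pen : Obs (2 + r)
    obs-pen = step (3 + r) (2 + r) ≤-refl obs-last (down (2 + r)) last-nbrs

  -- v is vertex 1: it observes 0, 1 and 2.
  at-1 : toℕ v ≡ 1 → IsPDS G ⁅ v ⁆
  at-1 v-at =
    from-hub-and-1 1 v-at (seed 0 (inj₂ (down 0))) obs₁ 1 ≤-refl (s≤s (s≤s (s≤s z≤n)))
      obs₁ (seed 2 (inj₂ (up 1)))
    where
    open Seed 1 v-at
    obs₁ : Obs 1
    obs₁ = seed 1 (inj₁ refl)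

  -- v lies in [2, j]: it observes itself and its predecessor.
  low : ∀ t → 2 + t ≤ j → toℕ v ≡ 2 + t → IsPDS G ⁅ v ⁆
  low t 2+t≤j v-at = from-low-pair (2 + t) v-at (suc t) (s≤s z≤n) 2+t≤j
    (seed (suc t) (inj₂ (down (suc t)))) (seed (2 + t) (inj₁ refl))
    where open Seed (2 + t) v-at

  -- v is the last vertex: it observes the hub and its predecessor.
  at-last : toℕ v ≡ 3 + r → IsPDS G ⁅ v ⁆
  at-last v-at =
    from-high-pair (3 + r) v-at (seed 0 (inj₂ (inj₁ (inj₁ (inj₂ (inj₂ (refl , refl)))))))
      (2 + r) j<2+r ≤-refl
    (seed (2 + r) (inj₂ (down (2 + r)))) (seed (3 + r) (inj₁ refl))
    where open Seed (3 + r) v-at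

  -- v lies strictly between j and the last vertex: it observes itself and its
  -- successor, and the hub directly (v a chord end) or by sweeping upwards.
  high : ∀ s → j < s → s < 3 + r → toℕ v ≡ s → IsPDS G ⁅ v ⁆
  high s j<s s<3+r v-at = from-high-pair s v-at obs₀ s j<s (s≤s s<3+r) obs-v obs-next
    where
    open Seed s v-at
    obs-v : Obs s
    obs-v = seed s (inj₁ refl)
    obs-next : Obs (suc s)
    obs-next = seed (suc s) (inj₂ (up s))
    obs₀ : Obs 0
    obs₀ with suc s <? 5 + p + k
    ... | yes hi = seed 0 (inj₂ (inj₁ (inj₂ (inj₂ (refl , s≤s j<s , hi)))))
    ... | no not-chord = reach-hub-up s v-at s j<s (s≤s s<3+r)
          (λ x s+1≤x (_ , hi) → not-chord (≤-trans (s≤s s+1≤x) (<⇒≤ hi))) obs-v obs-next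

  pds : IsPDS G ⁅ v ⁆
  pds = by-index (toℕ v) refl (toℕ<n v)
    where
    by-index : ∀ s → toℕ v ≡ s → s < 4 + r → IsPDS G ⁅ v ⁆
    by-index zero v-at _ = at-hub v-at
    by-index (suc zero) v-at _ = at-1 v-at
    by-index (suc (suc t)) v-at s<n with 2 + t ≤? j
    ... | yes 2+t≤j = low t 2+t≤j v-at
    ... | no 2+t≰j with m≤n⇒m<n∨m≡n (≤-pred s<n)
    ...   | inj₁ s<3+r = high (2 + t) (≰⇒> 2+t≰j) s<3+r v-at
    ...   | inj₂ refl = at-last v-at

module Join where
  open Closure

  induced-pds : ∀ {a b} (G : Adj a) (J : Adj b) (f : Fin a → Fin b) (T : Subset b) (s : Fin a)
    → (∀ x u → InN G x u → InN J (f x) (f u))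
    → (∀ x u → InN J (f x) (f u) → InN G x u)
    → (∀ w → (∃[ u ] w ≡ f u) ⊎ Observed J T w)
    → f s ∈ T → IsPDS G ⁅ s ⁆ → IsPDS J T
  induced-pds G J f T s pres reflect cover fs∈T pds w with cover w
  ... | inj₂ observed = observed
  ... | inj₁ (u , refl) = transfer G J f ⁅ s ⁆ T pres back base (proj₁ (pds u)) u (proj₂ (pds u))
    where
    back : ∀ x u′ → InN J (f x) u′ → (∃[ u ] (u′ ≡ f u × InN G x u)) ⊎ Observed J T u′
    back x u′ h with cover u′
    ... | inj₂ observed = inj₂ observed
    ... | inj₁ (u , refl) = inj₁ (u , refl , reflect x u h)
    base : ∀ v w → v ∈ ⁅ s ⁆ → InN G v w → Observed J T (f w)
    base v w v∈ h with x∈⁅y⁆⇒x≡y s v∈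
    ... | refl = 0 , f s , fs∈T , pres s w h

  module Sides {m n : ℕ} (G : Adj m) (H : Adj n) where
    J : Adj (m + n)
    J = join G H

    sides : ∀ w → (∃[ x ] w ≡ x ↑ˡ n) ⊎ (∃[ y ] w ≡ m ↑ʳ y)
    sides w with splitAt m w in eq
    ... | inj₁ x = inj₁ (x , sym (splitAt⁻¹-↑ˡ eq))
    ... | inj₂ y = inj₂ (y , sym (splitAt⁻¹-↑ʳ eq))

    left-left : ∀ x u → J (x ↑ˡ n) (u ↑ˡ n) ≡ G x u
    left-left x u rewrite splitAt-↑ˡ m x n | splitAt-↑ˡ m u n = refl

    right-right : ∀ x u → J (m ↑ʳ x) (m ↑ʳ u) ≡ H x u
    right-right x u rewrite splitAt-↑ʳ m n x | splitAt-↑ʳ m n u = refl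

    left-right : ∀ x y → J (x ↑ˡ n) (m ↑ʳ y) ≡ true
    left-right x y rewrite splitAt-↑ˡ m x n | splitAt-↑ʳ m n y = refl

    right-left : ∀ y x → J (m ↑ʳ y) (x ↑ˡ n) ≡ true
    right-left y x rewrite splitAt-↑ʳ m n y | splitAt-↑ˡ m x n = refl

    sees-right : ∀ T a → a ↑ˡ n ∈ T → ∀ y → Observed J T (m ↑ʳ y)
    sees-right T a t∈T y = 0 , a ↑ˡ n , t∈T , inj₂ (left-right a y)

    sees-left : ∀ T b → m ↑ʳ b ∈ T → ∀ x → Observed J T (x ↑ˡ n)
    sees-left T b t∈T x = 0 , m ↑ʳ b , t∈T , inj₂ (right-left b x)

    seed-left : ∀ T a → a ↑ˡ n ∈ T → IsPDS G ⁅ a ⁆ → IsPDS J T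
    seed-left T a t∈T = induced-pds G J (_↑ˡ n) T a pres reflect cover t∈T
      where
      pres : ∀ x u → InN G x u → InN J (x ↑ˡ n) (u ↑ˡ n)
      pres x u (inj₁ refl) = inj₁ refl
      pres x u (inj₂ e) = inj₂ (trans (left-left x u) e)
      reflect : ∀ x u → InN J (x ↑ˡ n) (u ↑ˡ n) → InN G x u
      reflect x u (inj₁ e) = inj₁ (↑ˡ-injective n u x e)
      reflect x u (inj₂ e) = inj₂ (trans (sym (left-left x u)) e)
      cover : ∀ w → (∃[ u ] w ≡ u ↑ˡ n) ⊎ Observed J T w
      cover w with sides w
      ... | inj₁ left = inj₁ left
      ... | inj₂ (y , refl) = inj₂ (sees-right T a t∈T y)

    seed-right : ∀ T b → m ↑ʳ b ∈ T → IsPDS H ⁅ b ⁆ → IsPDS J T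
    seed-right T b t∈T = induced-pds H J (m ↑ʳ_) T b pres reflect cover t∈T
      where
      pres : ∀ x u → InN H x u → InN J (m ↑ʳ x) (m ↑ʳ u)
      pres x u (inj₁ refl) = inj₁ refl
      pres x u (inj₂ e) = inj₂ (trans (right-right x u) e)
      reflect : ∀ x u → InN J (m ↑ʳ x) (m ↑ʳ u) → InN H x u
      reflect x u (inj₁ e) = inj₁ (↑ʳ-injective m u x e)
      reflect x u (inj₂ e) = inj₂ (trans (sym (right-right x u)) e)
      cover : ∀ w → (∃[ u ] w ≡ m ↑ʳ u) ⊎ Observed J T w
      cover w with sides w
      ... | inj₂ right = inj₁ right
      ... | inj₁ (x , refl) = inj₂ (sees-left T b t∈T x)

  other-vertex : ∀ (a b e : Fin 2) → a ≢ b → e ≢ a → e ≡ b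
  other-vertex fzero fzero _ a≢b _ = ⊥-elim (a≢b refl)
  other-vertex fzero (fsuc fzero) fzero _ e≢a = ⊥-elim (e≢a refl)
  other-vertex fzero (fsuc fzero) (fsuc fzero) _ _ = refl
  other-vertex (fsuc fzero) fzero fzero _ _ = refl
  other-vertex (fsuc fzero) fzero (fsuc fzero) _ e≢a = ⊥-elim (e≢a refl)
  other-vertex (fsuc fzero) (fsuc fzero) _ a≢b _ = ⊥-elim (a≢b refl)

  -- G ∨ K̄₂ with G nonempty: a seed t in K̄₂ observes all of G, and any
  -- vertex x of G then has the other vertex of K̄₂ as its only unobserved
  -- neighbour, so x forces it.
  module _ {m : ℕ} (G : Adj m) (H : Adj 2) where
    open Sides G H

    seed-in-K̄₂ : (∀ u v → H u v ≡ false) → Fin m → ∀ T a → m ↑ʳ a ∈ T → IsPDS J T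
    seed-in-K̄₂ edgeless x₀ T a t∈T w with sides w
    ... | inj₁ (x , refl) = sees-left T a t∈T x
    ... | inj₂ (b , refl) with a Fin.≟ b
    ...   | yes refl = 0 , m ↑ʳ a , t∈T , inj₁ refl
    ...   | no a≢b =
      force J T (x₀ ↑ˡ 2) (m ↑ʳ b) (sees-left T a t∈T x₀) (inj₂ (left-right x₀ b)) others
      where
      others : ∀ u → InN J (x₀ ↑ˡ 2) u → u ≡ m ↑ʳ b ⊎ Observed J T u
      others u _ with sides u
      ... | inj₁ (x , refl) = inj₂ (sees-left T a t∈T x)
      ... | inj₂ (e , refl) with e Fin.≟ a
      ...   | yes refl = inj₂ (0 , m ↑ʳ a , t∈T , inj₁ refl)
      ...   | no e≢a = inj₁ (cong (m ↑ʳ_) (other-vertex a b e a≢b e≢a))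

  join-never-fails : ∀ {m n} (G' : Adj m) (H : Adj n)
    → FPDSNumber G' 0
    → (FPDSNumber H 0 ⊎ (n ≡ 2 × (∀ (u v : Fin n) → H u v ≡ false)))
    → ∀ S → Nonempty S → ¬ IsFPDS (join G' H) S
  join-never-fails G' H zeroG' zeroH S (t , t∈S) fails with Sides.sides G' H t | zeroH
  ... | inj₁ (a , refl) | _ =
    singleton-never-fails G' zeroG' a (λ pds → fails (Sides.seed-left G' H S a t∈S pds))
  ... | inj₂ (b , refl) | inj₁ zeroH′ =
    singleton-never-fails H zeroH′ b (λ pds → fails (Sides.seed-right G' H S b t∈S pds))
  ... | inj₂ (b , refl) | inj₂ (refl , edgeless) =
    fails (seed-in-K̄₂ G' H edgeless (fpds-zero-vertex G' zeroG') S b t∈S)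

  join-fpds-zero : ∀ (m n : ℕ) (G' : Adj m) (H : Adj n)
    → FPDSNumber G' 0
    → (FPDSNumber H 0 ⊎ (n ≡ 2 × (∀ (u v : Fin n) → H u v ≡ false)))
    → FPDSNumber (join G' H) 0
  join-fpds-zero m n G' H zeroG' zeroH =
    fpds-zero (join G' H) (fpds-zero-vertex G' zeroG' ↑ˡ n) (join-never-fails G' H zeroG' zeroH)

open Closure using (fpds-zero-singletons)

complement-cycle-fpds : ∀ n → 5 ≤ n → FPDSNumber (compl (cycleG n)) 0
complement-cycle-fpds .(5 + r) (s≤s (s≤s (s≤s (s≤s (s≤s (z≤n {r})))))) =
  fpds-zero-singletons _ fzero (ComplementOfCycle.pds r)

complement-path-fpds : ∀ n → 4 ≤ n → FPDSNumber (compl (pathG n)) 0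
complement-path-fpds .(4 + r) (s≤s (s≤s (s≤s (s≤s (z≤n {r}))))) =
  fpds-zero-singletons _ fzero (ComplementOfPath.pds r)

fan-cycle-fpds : ∀ n i k → 4 ≤ n → FPDSNumber (fanCycle n i k) 0
fan-cycle-fpds .(4 + r) i k (s≤s (s≤s (s≤s (s≤s (z≤n {r}))))) =
  fpds-zero-singletons _ fzero (FanCycle.pds r i k)

fan-chord-fpds : ∀ n i k → 5 ≤ i → i < n → FPDSNumber (fanCycle' n i k) 0
fan-chord-fpds .(4 + r) .(5 + p) k (s≤s (s≤s (s≤s (s≤s (s≤s (z≤n {p}))))))
               (s≤s (s≤s (s≤s (s≤s {n = r} 2+p≤r)))) =
  fpds-zero-singletons _ fzero (FanCycleChord.pds r p k (s≤s (s≤s 2+p≤r)))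

chord-room : ∀ n i k → 1 ≤ k → i + k ≤ n ∸ 1 → i < n
chord-room n i k k≥1 i+k≤n-1 = ≤-trans (m<m+n i k≥1) (≤-trans i+k≤n-1 (m∸n≤m n 1))

theorem4 :
    (∀ (n : ℕ) → 5 ≤ n → FPDSNumber (compl (cycleG n)) 0)
    × (∀ (n : ℕ) → 4 ≤ n → FPDSNumber (compl (pathG n)) 0)
    × (∀ (n i k : ℕ) → 1 ≤ k → 3 ≤ i → 4 ≤ n → i + k ≤ n ∸ 1 → FPDSNumber (fanCycle n i k) 0)
    × (∀ (n i k : ℕ) → 1 ≤ k → 5 ≤ i → 6 ≤ n → i + k ≤ n ∸ 1 → FPDSNumber (fanCycle' n i k) 0)
    × (∀ (m n : ℕ) (G' : Adj m) (H : Adj n) → IsSimple G' → IsSimple H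
        → FPDSNumber G' 0
        → (FPDSNumber H 0 ⊎ (n ≡ 2 × (∀ (u v : Fin n) → H u v ≡ false)))
        → FPDSNumber (join G' H) 0)
theorem4 =
    complement-cycle-fpds
  , complement-path-fpds
  , (λ n i k _ _ 4≤n _ → fan-cycle-fpds n i k 4≤n)
  , (λ n i k k≥1 5≤i _ i+k≤n-1 → fan-chord-fpds n i k 5≤i (chord-room n i k k≥1 i+k≤n-1))
  , (λ m n G' H _ _ → Join.join-fpds-zero m n G' H)
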